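{- Let $T\in\mathbb{T}$ have a positive weight on each edge, and let $A$ be the adjacency matrix of $T$. Then there exists a signature matrix $S$ such that $SA^{\#}S$ is a non-negative matrix.
   Context: $\mathbb{T}$ is the class of simple undirected weighted trees $T$ such that (i) $T$ has at least one non-pendant vertex, and (ii) every non-pendant vertex of $T$ is adjacent to at least one pendant vertex (a vertex of degree one). The adjacency matrix $A$ has $(i,j)$ entry equal to the weight of edge $v_iv_j$, or $0$ if there is no such edge. $A^{\#}$ is the group inverse of $A$, the unique matrix $X$ with $AXA=A$, $XAX=X$, $AX=XA$. A signature matrix is a diagonal matrix with diagonal entries in $\{1,-1\}$. -}

module Defs where

open import Data.Nat using (ℕ; zero; suc)
import Data.Nat as ℕ
open import Data.Fin using (Fin; zero; suc)
open import Data.Bool using (Bool; true; false; if_then_else_)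
open import Data.List using (List; []; _∷_; _++_; [_]; length)
open import Data.List.Relation.Unary.Unique.Propositional using (Unique)
open import Data.Product using (Σ; ∃; _×_; _,_)
open import Data.Sum using (_⊎_)
open import Data.Unit using (⊤)
open import Relation.Nullary using (¬_)
open import Relation.Binary.PropositionalEquality using (_≡_; _≢_)
open import Relation.Binary.Core using (Rel)
open import Relation.Binary.Structures using (IsTotalOrder)
open import Algebra.Structures using (IsCommutativeRing)

-- Ordered fields (the standard library has no real numbers; we work over
-- an arbitrary ordered field, of which ℝ is an instance).

record OrderedField : Set₁ where
  infixl 6 _+_
  infixl 7 _*_
  infix 4 _≤_
  field
    Carrier : Set
    _+_ _*_ : Carrier → Carrier → Carrier
    -_      : Carrier → Carrier
    0# 1#   : Carrier
    isCommutativeRing : IsCommutativeRing _≡_ _+_ _*_ -_ 0# 1#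
    0≢1     : 0# ≢ 1#
    _⁻¹     : (x : Carrier) → x ≢ 0# → Carrier
    inverse : (x : Carrier) (p : x ≢ 0#) → x * (x ⁻¹) p ≡ 1#
    _≤_     : Rel Carrier _
    isTotalOrder : IsTotalOrder _≡_ _≤_
    +-mono-≤ : ∀ {x y} z → x ≤ y → x + z ≤ y + z
    *-nonneg : ∀ {x y} → 0# ≤ x → 0# ≤ y → 0# ≤ x * y

  _<_ : Carrier → Carrier → Set
  x < y = x ≤ y × x ≢ y

record SimpleGraph (n : ℕ) : Set where
  field
    E     : Fin n → Fin n → Bool
    sym   : ∀ i j → E i j ≡ E j i
    irrefl : ∀ i → E i i ≡ false

module _ {n : ℕ} (G : SimpleGraph n) where
  open SimpleGraph G

  Adj : Fin n → Fin n → Set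
  Adj i j = E i j ≡ true

  Chain : List (Fin n) → Set
  Chain []           = ⊤
  Chain (x ∷ [])     = ⊤
  Chain (x ∷ y ∷ xs) = Adj x y × Chain (y ∷ xs)

  Connected : Set
  Connected = ∀ u v → u ≢ v → ∃ λ xs → Chain (u ∷ xs ++ [ v ])

  IsCycle : Fin n → List (Fin n) → Fin n → Set
  IsCycle v₀ xs vₖ = 1 ℕ.≤ length xs × Unique (v₀ ∷ xs ++ [ vₖ ])
                     × Chain (v₀ ∷ xs ++ [ vₖ ]) × Adj vₖ v₀

  Acyclic : Set
  Acyclic = ∀ v₀ xs vₖ → ¬ IsCycle v₀ xs vₖ

  IsTree : Set
  IsTree = Connected × Acyclic

  countF : ∀ {m} → (Fin m → Bool) → ℕ
  countF {zero}  f = 0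
  countF {suc m} f = (if f zero then 1 else 0) ℕ.+ countF (λ i → f (suc i))

  degree : Fin n → ℕ
  degree v = countF (E v)

  Pendant : Fin n → Set
  Pendant v = degree v ≡ 1

  InClassT : Set
  InClassT = IsTree
           × (∃ λ v → ¬ Pendant v)
           × (∀ v → ¬ Pendant v → ∃ λ u → Adj v u × Pendant u)

module Matrices (F : OrderedField) where
  open OrderedField F

  infixl 7 _·_
  infix 4 _≐_

  Matrix : ℕ → Set
  Matrix n = Fin n → Fin n → Carrier

  sumF : ∀ {m} → (Fin m → Carrier) → Carrier
  sumF {zero}  f = 0#
  sumF {suc m} f = f zero + sumF (λ i → f (suc i))

  _·_ : ∀ {n} → Matrix n → Matrix n → Matrix n
  (A · B) i j = sumF (λ k → A i k * B k j)

  _≐_ : ∀ {n} → Matrix n → Matrix n → Set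
  A ≐ B = ∀ i j → A i j ≡ B i j

  IsGroupInverse : ∀ {n} → Matrix n → Matrix n → Set
  IsGroupInverse A X = ((A · X) · A ≐ A) × ((X · A) · X ≐ X) × (A · X ≐ X · A)

  IsSignatureMatrix : ∀ {n} → Matrix n → Set
  IsSignatureMatrix S = (∀ i j → i ≢ j → S i j ≡ 0#)
                      × (∀ i → S i i ≡ 1# ⊎ S i i ≡ - 1#)

  NonNegative : ∀ {n} → Matrix n → Set
  NonNegative M = ∀ i j → 0# ≤ M i j

  adjacency : ∀ {n} → SimpleGraph n → Matrix n → Matrix n
  adjacency G w i j = if SimpleGraph.E G i j then w i j else 0#

  SymmetricWeights : ∀ {n} → Matrix n → Set
  SymmetricWeights w = ∀ i j → w i j ≡ w j i

  PositiveWeights : ∀ {n} → SimpleGraph n → Matrix n → Set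
  PositiveWeights G w = ∀ i j → Adj G i j → 0# < w i j

{-# OPTIONS --safe #-}
-- Split the vertices into core (non-pendant) and pendant ones.  In a tree of this class
-- no two pendant vertices are adjacent and every core vertex has a pendant neighbour,
-- which no other core vertex shares.  Hence A = [[B, C], [C′, 0]] in block form, with
-- D = C C′ diagonal and invertible, and with Y = D⁻¹ C, Y′ = C′ D⁻¹ the matrix
-- [[0, Y], [Y′, -Y′ B Y]] is a group inverse of A; this is a computation valid in any
-- ring, and group inverses are unique.  A tree is bipartite; flipping the colour of the
-- pendant vertices gives signs s with s_i s_j = 1 across core–pendant edges and -1
-- across core–core edges.  Conjugating by S = diag s makes S Y S and S Y′ S nonnegative
-- and S B S nonpositive, so S A^# S = SYS + SY′S + (SY′S)(-SBS)(SYS) is nonnegative.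
module Submission where

open import Defs
open import Level using (0ℓ)
open import Data.Nat as ℕ using (ℕ; zero; suc; z≤n; s≤s)
open import Data.Fin as Fin using (Fin; zero; suc)
open import Data.Bool using (Bool; true; false; not; if_then_else_)
open import Data.List using (List; []; _∷_; _++_; [_]; length; reverse; _∷ʳ_; initLast; _∷ʳ′_)
open import Data.Product using (∃; _×_; _,_; proj₁; proj₂)
open import Data.Sum using (_⊎_; inj₁; inj₂)
import Data.Sum
open import Data.Empty using (⊥; ⊥-elim)
open import Data.Unit using (tt)
open import Data.Maybe using (nothing)
open import Function using (_∘_)
open import Relation.Nullary using (¬_; Dec; yes; no; does)
open import Relation.Nullary.Decidable using (dec-true; dec-false)
open import Relation.Binary.PropositionalEquality using (_≡_; _≢_; refl; module ≡-Reasoning)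
open import Relation.Binary.Bundles using (Poset)
open import Relation.Binary.Structures using (IsTotalOrder)
open import Algebra.Bundles using (CommutativeRing; RingWithoutOne; Semigroup)
import Algebra.Construct.Pointwise as Pointwise
open import Tactic.RingSolver.Core.AlmostCommutativeRing using (AlmostCommutativeRing; fromCommutativeRing)

module OrderedFieldProperties (F : OrderedField) where
  open import Relation.Binary.PropositionalEquality using (sym; trans; cong; cong₂)
  open OrderedField F

  commutativeRing : CommutativeRing 0ℓ 0ℓ
  commutativeRing = record { isCommutativeRing = isCommutativeRing }

  open CommutativeRing commutativeRing public
    using ( +-assoc; +-comm; +-identityˡ; +-identityʳ; -‿inverseˡ; -‿inverseʳ
          ; *-assoc; *-comm; *-identityˡ; *-identityʳ; distribˡ; distribʳ; zeroˡ; zeroʳ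
          ; +-isAbelianGroup; semiring; ring)
  open import Algebra.Properties.Ring ring public
    using (-‿distribˡ-*; -‿distribʳ-*; -‿involutive; -0#≈0#)

  ≤-poset : Poset 0ℓ 0ℓ 0ℓ
  ≤-poset = record { isPartialOrder = IsTotalOrder.isPartialOrder isTotalOrder }

  almostCommutativeRing : AlmostCommutativeRing 0ℓ 0ℓ
  almostCommutativeRing = fromCommutativeRing commutativeRing (λ _ → nothing)

  open import Tactic.RingSolver.NonReflective almostCommutativeRing public
    using (solve; _⊜_; _⊕_; _⊗_)

  open IsTotalOrder isTotalOrder public using (antisym; total) renaming (refl to ≤-refl)
  open import Relation.Binary.Reasoning.PartialOrder ≤-poset

  +-monoʳ-≤ : ∀ {x y} z → x ≤ y → z + x ≤ z + y
  +-monoʳ-≤ {x} {y} z x≤y = begin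
    z + x ≡⟨ +-comm z x ⟩
    x + z ≤⟨ +-mono-≤ z x≤y ⟩
    y + z ≡⟨ +-comm y z ⟩
    z + y ∎

  x≤x+y : ∀ {x y} → 0# ≤ y → x ≤ x + y
  x≤x+y {x} {y} 0≤y = begin
    x      ≡⟨ +-identityʳ x ⟨
    x + 0# ≤⟨ +-monoʳ-≤ x 0≤y ⟩
    x + y  ∎

  +-nonneg : ∀ {x y} → 0# ≤ x → 0# ≤ y → 0# ≤ x + y
  +-nonneg {x} {y} 0≤x 0≤y = begin
    0#     ≤⟨ 0≤x ⟩
    x      ≤⟨ x≤x+y 0≤y ⟩
    x + y  ∎

  x≤0⇒0≤-x : ∀ {x} → x ≤ 0# → 0# ≤ - x
  x≤0⇒0≤-x {x} x≤0 = begin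
    0#       ≡⟨ -‿inverseʳ x ⟨
    x + - x  ≤⟨ +-mono-≤ (- x) x≤0 ⟩
    0# + - x ≡⟨ +-identityˡ (- x) ⟩
    - x      ∎

  0≤-x⇒x≤0 : ∀ {x} → 0# ≤ - x → x ≤ 0#
  0≤-x⇒x≤0 {x} 0≤-x = begin
    x          ≡⟨ +-identityˡ x ⟨
    0# + x     ≤⟨ +-mono-≤ x 0≤-x ⟩
    - x + x    ≡⟨ -‿inverseˡ x ⟩
    0#         ∎

  0≤1 : 0# ≤ 1#
  0≤1 with total 0# 1#
  ... | inj₁ 0≤1 = 0≤1
  ... | inj₂ 1≤0 = begin
    0#            ≤⟨ *-nonneg 0≤-1 0≤-1 ⟩
    - 1# * - 1#   ≡⟨ -‿distribˡ-* 1# (- 1#) ⟨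
    - (1# * - 1#) ≡⟨ cong -_ (*-identityˡ (- 1#)) ⟩
    - - 1#        ≡⟨ -‿involutive 1# ⟩
    1#            ∎
    where
    0≤-1 : 0# ≤ - 1#
    0≤-1 = x≤0⇒0≤-x 1≤0

  *-nonzero : ∀ {x y} → x ≢ 0# → y ≢ 0# → x * y ≢ 0#
  *-nonzero {x} {y} x≢0 y≢0 xy≡0 = 0≢1 (begin-equality
    0#                  ≡⟨ zeroˡ (x⁻¹ * y⁻¹) ⟨
    0# * (x⁻¹ * y⁻¹)      ≡⟨ cong (_* (x⁻¹ * y⁻¹)) xy≡0 ⟨
    x * y * (x⁻¹ * y⁻¹)   ≡⟨ solve 4 (λ a b c d → a ⊗ b ⊗ (c ⊗ d) ⊜ a ⊗ c ⊗ (b ⊗ d)) refl x y x⁻¹ y⁻¹ ⟩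
    x * x⁻¹ * (y * y⁻¹)   ≡⟨ cong₂ _*_ (inverse x x≢0) (inverse y y≢0) ⟩
    1# * 1#             ≡⟨ *-identityˡ 1# ⟩
    1#                  ∎)
    where
    x⁻¹ = (x ⁻¹) x≢0
    y⁻¹ = (y ⁻¹) y≢0

  -1*x≡-x : ∀ x → - 1# * x ≡ - x
  -1*x≡-x x = trans (sym (-‿distribˡ-* 1# x)) (cong -_ (*-identityˡ x))

  x*-1≡-x : ∀ x → x * - 1# ≡ - x
  x*-1≡-x x = trans (sym (-‿distribʳ-* x 1#)) (cong -_ (*-identityʳ x))

  ⁻¹-nonneg : ∀ {x} (x≢0 : x ≢ 0#) → 0# ≤ x → 0# ≤ (x ⁻¹) x≢0
  ⁻¹-nonneg {x} x≢0 0≤x with total 0# ((x ⁻¹) x≢0)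
  ... | inj₁ 0≤x⁻¹ = 0≤x⁻¹
  ... | inj₂ x⁻¹≤0 = ⊥-elim (0≢1 (antisym 0≤1 (0≤-x⇒x≤0 0≤-1)))
    where
    0≤-1 : 0# ≤ - 1#
    0≤-1 = begin
      0#                    ≤⟨ *-nonneg 0≤x (x≤0⇒0≤-x x⁻¹≤0) ⟩
      x * - (x ⁻¹) x≢0      ≡⟨ -‿distribʳ-* x _ ⟨
      - (x * (x ⁻¹) x≢0)    ≡⟨ cong -_ (inverse x x≢0) ⟩
      - 1#                  ∎

  1*x*1≡x : ∀ x → 1# * x * 1# ≡ x
  1*x*1≡x x = trans (*-identityʳ (1# * x)) (*-identityˡ x)

  0*y*z≡0 : ∀ y z → 0# * y * z ≡ 0#
  0*y*z≡0 y z = trans (cong (_* z) (zeroˡ y)) (zeroˡ z)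

  x*y*0≡0 : ∀ x y → x * y * 0# ≡ 0#
  x*y*0≡0 x y = zeroʳ (x * y)

  y≡0⇒x*y*z≡0 : ∀ x z {y} → y ≡ 0# → x * y * z ≡ 0#
  y≡0⇒x*y*z≡0 x z refl = trans (cong (_* z) (zeroʳ x)) (zeroˡ z)

  ι : Bool → Carrier
  ι true  = 1#
  ι false = 0#

  ι-nonneg : ∀ b → 0# ≤ ι b
  ι-nonneg true  = 0≤1
  ι-nonneg false = ≤-refl

  ι-idem : ∀ b → ι b * ι b ≡ ι b
  ι-idem true  = *-identityˡ 1#
  ι-idem false = zeroˡ 0#

  ι-orthˡ : ∀ b → ι (not b) * ι b ≡ 0#
  ι-orthˡ true  = zeroˡ 1#
  ι-orthˡ false = zeroʳ 1#

  ι-orthʳ : ∀ b → ι b * ι (not b) ≡ 0#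
  ι-orthʳ b = trans (*-comm (ι b) (ι (not b))) (ι-orthˡ b)

  ι-compl : ∀ b → ι (not b) + ι b ≡ 1#
  ι-compl true  = +-identityˡ 1#
  ι-compl false = +-identityʳ 1#

module ParitySign (F : OrderedField) where
  open import Data.Parity.Base using (Parity; 0ℙ; 1ℙ; _⁻¹)
  open import Relation.Binary.PropositionalEquality using (trans; cong)
  open OrderedField F hiding (_⁻¹)
  open OrderedFieldProperties F

  sign : Parity → Carrier
  sign 0ℙ = 1#
  sign 1ℙ = - 1#

  sign-±1 : ∀ p → sign p ≡ 1# ⊎ sign p ≡ - 1#
  sign-±1 0ℙ = inj₁ refl
  sign-±1 1ℙ = inj₂ refl

  sign-square : ∀ p → sign p * sign p ≡ 1#
  sign-square 0ℙ = *-identityˡ 1#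
  sign-square 1ℙ = trans (-1*x≡-x (- 1#)) (-‿involutive 1#)

  sign-conj : ∀ p x → sign p * x * sign p ≡ x
  sign-conj 0ℙ x = 1*x*1≡x x
  sign-conj 1ℙ x = trans (x*-1≡-x (- 1# * x)) (trans (cong -_ (-1*x≡-x x)) (-‿involutive x))

  sign-conj-flip : ∀ p x → sign p * x * sign (p ⁻¹) ≡ - x
  sign-conj-flip 0ℙ x = trans (x*-1≡-x (1# * x)) (cong -_ (*-identityˡ x))
  sign-conj-flip 1ℙ x = trans (*-identityʳ (- 1# * x)) (-1*x≡-x x)

module SumProperties (F : OrderedField) where
  open import Data.Fin.Properties using (suc-injective)
  open import Relation.Binary.PropositionalEquality using (cong; cong₂)
  open OrderedField F
  open OrderedFieldProperties F
  open Matrices F using (sumF)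
  open import Algebra.Properties.Semiring.Sum semiring
    using (sum; sum-cong-≗; sum-replicate-zero; ∑-distrib-+; ∑-comm; *-distribˡ-sum; *-distribʳ-sum)
  open import Relation.Binary.Reasoning.PartialOrder ≤-poset

  sumF≡sum : ∀ {m} (f : Fin m → Carrier) → sumF f ≡ sum f
  sumF≡sum {zero}  f = refl
  sumF≡sum {suc m} f = cong (f zero +_) (sumF≡sum (f ∘ suc))

  sumF-cong : ∀ {m} {f g : Fin m → Carrier} → (∀ k → f k ≡ g k) → sumF f ≡ sumF g
  sumF-cong {f = f} {g} f≗g = begin-equality
    sumF f ≡⟨ sumF≡sum f ⟩
    sum f  ≡⟨ sum-cong-≗ f≗g ⟩
    sum g  ≡⟨ sumF≡sum g ⟨
    sumF g ∎

  sumF-zero : ∀ {m} {f : Fin m → Carrier} → (∀ k → f k ≡ 0#) → sumF f ≡ 0#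
  sumF-zero {m} {f} f≗0 = begin-equality
    sumF f               ≡⟨ sumF-cong {g = λ _ → 0#} f≗0 ⟩
    sumF {m} (λ _ → 0#)  ≡⟨ sumF≡sum {m} (λ _ → 0#) ⟩
    sum {m} (λ _ → 0#)   ≡⟨ sum-replicate-zero m ⟩
    0#                   ∎

  sumF-distrib-+ : ∀ {m} (f g : Fin m → Carrier) → sumF (λ k → f k + g k) ≡ sumF f + sumF g
  sumF-distrib-+ f g = begin-equality
    sumF (λ k → f k + g k) ≡⟨ sumF≡sum (λ k → f k + g k) ⟩
    sum (λ k → f k + g k)  ≡⟨ ∑-distrib-+ f g ⟩
    sum f + sum g          ≡⟨ cong₂ _+_ (sumF≡sum f) (sumF≡sum g) ⟨
    sumF f + sumF g        ∎

  *-distribˡ-sumF : ∀ {m} x (f : Fin m → Carrier) → x * sumF f ≡ sumF (λ k → x * f k)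
  *-distribˡ-sumF x f = begin-equality
    x * sumF f             ≡⟨ cong (x *_) (sumF≡sum f) ⟩
    x * sum f              ≡⟨ *-distribˡ-sum x f ⟩
    sum (λ k → x * f k)    ≡⟨ sumF≡sum (λ k → x * f k) ⟨
    sumF (λ k → x * f k)   ∎

  *-distribʳ-sumF : ∀ {m} x (f : Fin m → Carrier) → sumF f * x ≡ sumF (λ k → f k * x)
  *-distribʳ-sumF x f = begin-equality
    sumF f * x             ≡⟨ cong (_* x) (sumF≡sum f) ⟩
    sum f * x              ≡⟨ *-distribʳ-sum x f ⟩
    sum (λ k → f k * x)    ≡⟨ sumF≡sum (λ k → f k * x) ⟨
    sumF (λ k → f k * x)   ∎

  sumF-comm : ∀ {m l} (f : Fin m → Fin l → Carrier) →
              sumF (λ i → sumF (f i)) ≡ sumF (λ j → sumF (λ i → f i j))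
  sumF-comm f = begin-equality
    sumF (λ i → sumF (f i))           ≡⟨ sumF-cong (λ i → sumF≡sum (f i)) ⟩
    sumF (λ i → sum (f i))            ≡⟨ sumF≡sum (λ i → sum (f i)) ⟩
    sum (λ i → sum (f i))             ≡⟨ ∑-comm f ⟩
    sum (λ j → sum (λ i → f i j))     ≡⟨ sumF≡sum (λ j → sum (λ i → f i j)) ⟨
    sumF (λ j → sum (λ i → f i j))    ≡⟨ sumF-cong (λ j → sumF≡sum (λ i → f i j)) ⟨
    sumF (λ j → sumF (λ i → f i j))   ∎

  sumF-single : ∀ {m} (f : Fin m → Carrier) i → (∀ k → k ≢ i → f k ≡ 0#) → sumF f ≡ f i
  sumF-single {suc m} f zero    f≡0 = begin-equality
    f zero + sumF (f ∘ suc) ≡⟨ cong (f zero +_) (sumF-zero (λ k → f≡0 (suc k) λ ())) ⟩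
    f zero + 0#             ≡⟨ +-identityʳ (f zero) ⟩
    f zero                  ∎
  sumF-single {suc m} f (suc i) f≡0 = begin-equality
    f zero + sumF (f ∘ suc) ≡⟨ cong₂ _+_ (f≡0 zero λ ()) (sumF-single (f ∘ suc) i λ k k≢i → f≡0 (suc k) (k≢i ∘ suc-injective)) ⟩
    0# + f (suc i)          ≡⟨ +-identityˡ (f (suc i)) ⟩
    f (suc i)               ∎

  sumF-nonneg : ∀ {m} {f : Fin m → Carrier} → (∀ k → 0# ≤ f k) → 0# ≤ sumF f
  sumF-nonneg {zero}  0≤f = ≤-refl
  sumF-nonneg {suc m} 0≤f = +-nonneg (0≤f zero) (sumF-nonneg (0≤f ∘ suc))

  term≤sumF : ∀ {m} {f : Fin m → Carrier} → (∀ k → 0# ≤ f k) → ∀ i → f i ≤ sumF f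
  term≤sumF {suc m} {f} 0≤f zero    = x≤x+y (sumF-nonneg (0≤f ∘ suc))
  term≤sumF {suc m} {f} 0≤f (suc i) = begin
    f (suc i)               ≤⟨ term≤sumF (0≤f ∘ suc) i ⟩
    sumF (f ∘ suc)          ≡⟨ +-identityˡ _ ⟨
    0# + sumF (f ∘ suc)     ≤⟨ +-mono-≤ _ (0≤f zero) ⟩
    f zero + sumF (f ∘ suc) ∎

  sumF-nonzero : ∀ {m} {f : Fin m → Carrier} → (∀ k → 0# ≤ f k) → ∀ i → f i ≢ 0# → sumF f ≢ 0#
  sumF-nonzero {f = f} 0≤f i fi≢0 sum≡0 = fi≢0 (antisym (begin
    f i     ≤⟨ term≤sumF 0≤f i ⟩
    sumF f  ≡⟨ sum≡0 ⟩
    0#      ∎) (0≤f i))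

module MatrixRing (F : OrderedField) where
  open import Relation.Binary.PropositionalEquality using (sym; trans; cong; cong₂; subst)
  open OrderedField F
  open OrderedFieldProperties F
  open SumProperties F
  open Matrices F

  infixl 6 _+ᴹ_
  infix  8 -ᴹ_

  _+ᴹ_ : ∀ {n} → Matrix n → Matrix n → Matrix n
  (A +ᴹ B) i j = A i j + B i j

  -ᴹ_ : ∀ {n} → Matrix n → Matrix n
  (-ᴹ A) i j = - A i j

  0ᴹ : ∀ {n} → Matrix n
  0ᴹ i j = 0#

  module _ {n : ℕ} where
    open ≡-Reasoning

    ·-cong : {A A′ B B′ : Matrix n} → A ≐ A′ → B ≐ B′ → A · B ≐ A′ · B′
    ·-cong A≐A′ B≐B′ i j = sumF-cong λ k → cong₂ _*_ (A≐A′ i k) (B≐B′ k j)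

    ·-assoc : (A B C : Matrix n) → (A · B) · C ≐ A · (B · C)
    ·-assoc A B C i j = begin
      sumF (λ l → sumF (λ k → A i k * B k l) * C l j)   ≡⟨ sumF-cong (λ l → *-distribʳ-sumF (C l j) (λ k → A i k * B k l)) ⟩
      sumF (λ l → sumF (λ k → A i k * B k l * C l j))   ≡⟨ sumF-comm (λ l k → A i k * B k l * C l j) ⟩
      sumF (λ k → sumF (λ l → A i k * B k l * C l j))   ≡⟨ sumF-cong (λ k → sumF-cong λ l → *-assoc (A i k) (B k l) (C l j)) ⟩
      sumF (λ k → sumF (λ l → A i k * (B k l * C l j))) ≡⟨ sumF-cong (λ k → *-distribˡ-sumF (A i k) (λ l → B k l * C l j)) ⟨
      sumF (λ k → A i k * sumF (λ l → B k l * C l j))   ∎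

    ·-distribˡ : (A B C : Matrix n) → A · (B +ᴹ C) ≐ A · B +ᴹ A · C
    ·-distribˡ A B C i j = begin
      sumF (λ k → A i k * (B k j + C k j))              ≡⟨ sumF-cong (λ k → distribˡ (A i k) (B k j) (C k j)) ⟩
      sumF (λ k → A i k * B k j + A i k * C k j)        ≡⟨ sumF-distrib-+ (λ k → A i k * B k j) (λ k → A i k * C k j) ⟩
      (A · B) i j + (A · C) i j                         ∎

    ·-distribʳ : (A B C : Matrix n) → (B +ᴹ C) · A ≐ B · A +ᴹ C · A
    ·-distribʳ A B C i j = begin
      sumF (λ k → (B i k + C i k) * A k j)              ≡⟨ sumF-cong (λ k → distribʳ (A k j) (B i k) (C i k)) ⟩
      sumF (λ k → B i k * A k j + C i k * A k j)        ≡⟨ sumF-distrib-+ (λ k → B i k * A k j) (λ k → C i k * A k j) ⟩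
      (B · A) i j + (C · A) i j                         ∎

  matrixRing : ℕ → RingWithoutOne 0ℓ 0ℓ
  matrixRing n = record
    { Carrier = Matrix n
    ; _≈_     = _≐_
    ; _+_     = _+ᴹ_
    ; _*_     = _·_
    ; -_      = -ᴹ_
    ; 0#      = 0ᴹ
    ; isRingWithoutOne = record
      { +-isAbelianGroup = Pointwise.isAbelianGroup (Fin n) (Pointwise.isAbelianGroup (Fin n) +-isAbelianGroup)
      ; *-cong           = ·-cong
      ; *-assoc          = ·-assoc
      ; distrib          = ·-distribˡ , ·-distribʳ
      }
    }

  diag : ∀ {n} → (Fin n → Carrier) → Matrix n
  diag u i j = if does (i Fin.≟ j) then u i else 0#

  module _ {n : ℕ} where
    open ≡-Reasoning

    diag-on : (u : Fin n → Carrier) (i : Fin n) → diag u i i ≡ u i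
    diag-on u i = cong (if_then u i else 0#) (dec-true (i Fin.≟ i) refl)

    diag-off : (u : Fin n → Carrier) {i j : Fin n} → i ≢ j → diag u i j ≡ 0#
    diag-off u {i} {j} i≢j = cong (if_then u i else 0#) (dec-false (i Fin.≟ j) i≢j)

    diag-· : (u : Fin n → Carrier) (M : Matrix n) → ∀ i j → (diag u · M) i j ≡ u i * M i j
    diag-· u M i j = begin
      sumF (λ k → diag u i k * M k j) ≡⟨ sumF-single _ i (λ k k≢i → trans (cong (_* M k j) (diag-off u (k≢i ∘ sym))) (zeroˡ _)) ⟩
      diag u i i * M i j              ≡⟨ cong (_* M i j) (diag-on u i) ⟩
      u i * M i j                     ∎

    ·-diag : (M : Matrix n) (u : Fin n → Carrier) → ∀ i j → (M · diag u) i j ≡ M i j * u j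
    ·-diag M u i j = begin
      sumF (λ k → M i k * diag u k j) ≡⟨ sumF-single _ j (λ k k≢j → trans (cong (M i k *_) (diag-off u k≢j)) (zeroʳ _)) ⟩
      M i j * diag u j j              ≡⟨ cong (M i j *_) (diag-on u j) ⟩
      M i j * u j                     ∎

    diag-·-diag : (u v : Fin n → Carrier) → diag u · diag v ≐ diag (λ i → u i * v i)
    diag-·-diag u v i j with i Fin.≟ j
    ... | yes refl = trans (diag-· u (diag v) i i) (cong (u i *_) (diag-on v i))
    ... | no i≢j   = trans (diag-· u (diag v) i j) (trans (cong (u i *_) (diag-off v i≢j)) (zeroʳ (u i)))

    diag-·-·-diag : (u : Fin n → Carrier) (M : Matrix n) (v : Fin n → Carrier) →
                    ∀ i j → (diag u · M · diag v) i j ≡ u i * M i j * v j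
    diag-·-·-diag u M v i j = trans (·-diag (diag u · M) v i j) (cong (_* v j) (diag-· u M i j))

    diag-cong : {u v : Fin n → Carrier} → (∀ i → u i ≡ v i) → diag u ≐ diag v
    diag-cong {u} {v} u≗v i j with does (i Fin.≟ j)
    ... | true  = u≗v i
    ... | false = refl

    diagonal : (M : Matrix n) → (∀ i j → i ≢ j → M i j ≡ 0#) → M ≐ diag (λ i → M i i)
    diagonal M off≡0 i j with i Fin.≟ j
    ... | yes refl = refl
    ... | no  i≢j  = off≡0 i j i≢j

    diag-zero : diag {n} (λ _ → 0#) ≐ 0ᴹ
    diag-zero i j with does (i Fin.≟ j)
    ... | true  = refl
    ... | false = refl

    NonNegative-resp : {A B : Matrix n} → A ≐ B → NonNegative B → NonNegative A
    NonNegative-resp A≐B 0≤B i j = subst (0# ≤_) (sym (A≐B i j)) (0≤B i j)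

    +ᴹ-nonneg : {A B : Matrix n} → NonNegative A → NonNegative B → NonNegative (A +ᴹ B)
    +ᴹ-nonneg 0≤A 0≤B i j = +-nonneg (0≤A i j) (0≤B i j)

    ·-nonneg : {A B : Matrix n} → NonNegative A → NonNegative B → NonNegative (A · B)
    ·-nonneg 0≤A 0≤B i j = sumF-nonneg λ k → *-nonneg (0≤A i k) (0≤B k j)

module GroupInverse {c ℓ} (S : Semigroup c ℓ) where
  open Semigroup S
  open import Relation.Binary.Reasoning.Setoid setoid

  IsGroupInverseOf : Carrier → Carrier → Set ℓ
  IsGroupInverseOf a x = (a ∙ x) ∙ a ≈ a × (x ∙ a) ∙ x ≈ x × a ∙ x ≈ x ∙ a

  groupInverse-resp : ∀ {a b x} → a ≈ b → IsGroupInverseOf b x → IsGroupInverseOf a x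
  groupInverse-resp {a} {b} {x} a≈b (bxb≈b , xbx≈x , bx≈xb) =
    (begin (a ∙ x) ∙ a ≈⟨ ∙-cong (∙-congʳ a≈b) a≈b ⟩ (b ∙ x) ∙ b ≈⟨ bxb≈b ⟩ b ≈⟨ a≈b ⟨ a ∎) ,
    (begin (x ∙ a) ∙ x ≈⟨ ∙-congʳ (∙-congˡ a≈b) ⟩ (x ∙ b) ∙ x ≈⟨ xbx≈x ⟩ x ∎) ,
    (begin a ∙ x ≈⟨ ∙-congʳ a≈b ⟩ b ∙ x ≈⟨ bx≈xb ⟩ x ∙ b ≈⟨ ∙-congˡ a≈b ⟨ x ∙ a ∎)

  groupInverse-unique : ∀ {a x y} → IsGroupInverseOf a x → IsGroupInverseOf a y → x ≈ y
  groupInverse-unique {a} {x} {y} (axa≈a , xax≈x , ax≈xa) (aya≈a , yay≈y , ay≈ya) = begin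
    x                ≈⟨ xax≈x ⟨
    (x ∙ a) ∙ x      ≈⟨ assoc x a x ⟩
    x ∙ (a ∙ x)      ≈⟨ ∙-congˡ ax≈ay ⟩
    x ∙ (a ∙ y)      ≈⟨ assoc x a y ⟨
    (x ∙ a) ∙ y      ≈⟨ ∙-congʳ (trans (sym ax≈xa) ax≈ay) ⟩
    (a ∙ y) ∙ y      ≈⟨ ∙-congʳ ay≈ya ⟩
    (y ∙ a) ∙ y      ≈⟨ yay≈y ⟩
    y                ∎
    where
    a[ax]≈a : a ∙ (a ∙ x) ≈ a
    a[ax]≈a = begin
      a ∙ (a ∙ x)  ≈⟨ ∙-congˡ ax≈xa ⟩
      a ∙ (x ∙ a)  ≈⟨ assoc a x a ⟨
      (a ∙ x) ∙ a  ≈⟨ axa≈a ⟩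
      a            ∎
    ax≈ay : a ∙ x ≈ a ∙ y
    ax≈ay = begin
      a ∙ x                ≈⟨ ∙-congʳ aya≈a ⟨
      ((a ∙ y) ∙ a) ∙ x    ≈⟨ assoc (a ∙ y) a x ⟩
      (a ∙ y) ∙ (a ∙ x)    ≈⟨ ∙-congʳ ay≈ya ⟩
      (y ∙ a) ∙ (a ∙ x)    ≈⟨ assoc y a (a ∙ x) ⟩
      y ∙ (a ∙ (a ∙ x))    ≈⟨ ∙-congˡ a[ax]≈a ⟩
      y ∙ a                ≈⟨ ay≈ya ⟨
      a ∙ y                ∎

module PeirceGroupInverse {r ℓ} (R : RingWithoutOne r ℓ) where
  open RingWithoutOne R
  open import Algebra.Properties.RingWithoutOne R using (-‿distribˡ-*; x[y-z]≈xy-xz; -0#≈0#; xyx⁻¹≈y)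
  open GroupInverse *-semigroup using (IsGroupInverseOf)
  open import Relation.Binary.Reasoning.Setoid setoid

  *-annihilateˡ : ∀ {u v q} → u * v ≈ 0# → v * q ≈ q → u * q ≈ 0#
  *-annihilateˡ {u} {v} {q} uv≈0 vq≈q = begin
    u * q        ≈⟨ *-congˡ vq≈q ⟨
    u * (v * q)  ≈⟨ *-assoc u v q ⟨
    u * v * q    ≈⟨ *-congʳ uv≈0 ⟩
    0# * q       ≈⟨ zeroˡ q ⟩
    0#           ∎

  *-annihilate : ∀ {p u v q} → p * u ≈ p → u * v ≈ 0# → v * q ≈ q → p * q ≈ 0#
  *-annihilate {p} {u} {v} {q} pu≈p uv≈0 vq≈q = begin
    p * q        ≈⟨ *-congʳ pu≈p ⟨
    p * u * q    ≈⟨ *-assoc p u q ⟩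
    p * (u * q)  ≈⟨ *-congˡ (*-annihilateˡ uv≈0 vq≈q) ⟩
    p * 0#       ≈⟨ zeroʳ p ⟩
    0#           ∎

  idempotent-absorbˡ : ∀ {e} → e * e ≈ e → ∀ z w → e * (e * z * w) ≈ e * z * w
  idempotent-absorbˡ {e} ee≈e z w = begin
    e * (e * z * w)  ≈⟨ *-assoc e (e * z) w ⟨
    e * (e * z) * w  ≈⟨ *-congʳ (*-assoc e e z) ⟨
    e * e * z * w    ≈⟨ *-congʳ (*-congʳ ee≈e) ⟩
    e * z * w        ∎

  idempotent-absorbʳ : ∀ {e} → e * e ≈ e → ∀ z → z * e * e ≈ z * e
  idempotent-absorbʳ {e} ee≈e z = trans (*-assoc z e e) (*-congˡ ee≈e)

  x+0-0≈x : ∀ x → x + 0# - 0# ≈ x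
  x+0-0≈x x = trans (+-cong (+-identityʳ x) -0#≈0#) (+-identityʳ x)

  x+[y-x]≈y : ∀ x y → x + (y - x) ≈ y
  x+[y-x]≈y x y = trans (sym (+-assoc x y (- x))) (xyx⁻¹≈y x y)

  x+[y+z]-y≈x+z : ∀ x y z → x + (y + z) - y ≈ x + z
  x+[y+z]-y≈x+z x y z = begin
    x + (y + z) - y   ≈⟨ +-congʳ (+-assoc x y z) ⟨
    x + y + z - y     ≈⟨ +-congʳ (+-congʳ (+-comm x y)) ⟩
    y + x + z - y     ≈⟨ +-congʳ (+-assoc y x z) ⟩
    y + (x + z) - y   ≈⟨ xyx⁻¹≈y y (x + z) ⟩
    x + z             ∎

  module PeirceBlocks (e f a : Carrier) where
    b c c′ : Carrier
    b  = e * a * e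
    c  = e * a * f
    c′ = f * a * e

  -- With e, f the core and pendant projections and d = (c c′)⁻¹ on the core,
  -- b + c + c′ is the block matrix [[B, C], [C′, 0]] and x is [[0, Y], [Y′, -Y′ B Y]].
  module PeirceInverse (e f a d : Carrier) where
    open PeirceBlocks e f a public

    y y′ w x : Carrier
    y  = d * c
    y′ = c′ * d
    w  = y′ * b * y
    x  = y + y′ - w

    module _ (ee≈e : e * e ≈ e) (ff≈f : f * f ≈ f) (ef≈0 : e * f ≈ 0#) (fe≈0 : f * e ≈ 0#)
             (ed≈d : e * d ≈ d) (de≈d : d * e ≈ d)
             (cy′≈e : c * y′ ≈ e) (yc′≈e : y * c′ ≈ e) where

      eb≈b : e * b ≈ b
      eb≈b = idempotent-absorbˡ ee≈e a e
      be≈b : b * e ≈ b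
      be≈b = idempotent-absorbʳ ee≈e (e * a)
      ec≈c : e * c ≈ c
      ec≈c = idempotent-absorbˡ ee≈e a f
      cf≈c : c * f ≈ c
      cf≈c = idempotent-absorbʳ ff≈f (e * a)
      fc′≈c′ : f * c′ ≈ c′
      fc′≈c′ = idempotent-absorbˡ ff≈f a e
      c′e≈c′ : c′ * e ≈ c′
      c′e≈c′ = idempotent-absorbʳ ee≈e (f * a)
      ey≈y : e * y ≈ y
      ey≈y = trans (sym (*-assoc e d c)) (*-congʳ ed≈d)
      yf≈y : y * f ≈ y
      yf≈y = trans (*-assoc d c f) (*-congˡ cf≈c)
      fy′≈y′ : f * y′ ≈ y′
      fy′≈y′ = trans (sym (*-assoc f c′ d)) (*-congʳ fc′≈c′)
      y′e≈y′ : y′ * e ≈ y′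
      y′e≈y′ = trans (*-assoc c′ d e) (*-congˡ de≈d)

      by′≈0 : b * y′ ≈ 0#
      by′≈0 = *-annihilate be≈b ef≈0 fy′≈y′
      cy≈0 : c * y ≈ 0#
      cy≈0 = *-annihilate cf≈c fe≈0 ey≈y
      c′y′≈0 : c′ * y′ ≈ 0#
      c′y′≈0 = *-annihilate c′e≈c′ ef≈0 fy′≈y′
      yb≈0 : y * b ≈ 0#
      yb≈0 = *-annihilate yf≈y fe≈0 eb≈b
      yc≈0 : y * c ≈ 0#
      yc≈0 = *-annihilate yf≈y fe≈0 ec≈c
      y′c′≈0 : y′ * c′ ≈ 0#
      y′c′≈0 = *-annihilate y′e≈y′ ef≈0 fc′≈c′
      ey′≈0 : e * y′ ≈ 0#
      ey′≈0 = *-annihilateˡ ef≈0 fy′≈y′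
      ec′≈0 : e * c′ ≈ 0#
      ec′≈0 = *-annihilateˡ ef≈0 fc′≈c′

      c′y≈y′c : c′ * y ≈ y′ * c
      c′y≈y′c = sym (*-assoc c′ d c)

      -- a x ≈ x a ≈ e + c′ y, a projection fixing a and x
      π : Carrier
      π = e + c′ * y

      *-w : ∀ p → p * w ≈ p * y′ * b * y
      *-w p = begin
        p * (y′ * b * y)    ≈⟨ *-assoc p (y′ * b) y ⟨
        p * (y′ * b) * y    ≈⟨ *-congʳ (*-assoc p y′ b) ⟨
        p * y′ * b * y      ∎

      *-w≈0 : ∀ {p} → p * y′ ≈ 0# → p * w ≈ 0#
      *-w≈0 {p} py′≈0 = begin
        p * w           ≈⟨ *-w p ⟩
        p * y′ * b * y  ≈⟨ *-congʳ (*-congʳ py′≈0) ⟩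
        0# * b * y      ≈⟨ *-congʳ (zeroˡ b) ⟩
        0# * y          ≈⟨ zeroˡ y ⟩
        0#              ∎

      *-x : ∀ p → p * x ≈ p * y + p * y′ - p * w
      *-x p = trans (x[y-z]≈xy-xz p (y + y′) w) (+-congʳ (distribˡ p y y′))

      x-* : ∀ q → x * q ≈ y * q + y′ * q - w * q
      x-* q = begin
        (y + y′ + - w) * q       ≈⟨ distribʳ q (y + y′) (- w) ⟩
        (y + y′) * q + - w * q   ≈⟨ +-cong (distribʳ q y y′) (sym (-‿distribˡ-* w q)) ⟩
        y * q + y′ * q - w * q   ∎

      a-* : ∀ q → (b + c + c′) * q ≈ b * q + c * q + c′ * q
      a-* q = trans (distribʳ q (b + c) c′) (+-congʳ (distribʳ q b c))

      *-a : ∀ p → p * (b + c + c′) ≈ p * b + p * c + p * c′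
      *-a p = trans (distribˡ p (b + c) c′) (+-congʳ (distribˡ p b c))

      bx≈by : b * x ≈ b * y
      bx≈by = begin
        b * x                     ≈⟨ *-x b ⟩
        b * y + b * y′ - b * w    ≈⟨ +-cong (+-congˡ by′≈0) (-‿cong (*-w≈0 by′≈0)) ⟩
        b * y + 0# - 0#           ≈⟨ x+0-0≈x (b * y) ⟩
        b * y                     ∎

      cx≈e-by : c * x ≈ e - b * y
      cx≈e-by = begin
        c * x                     ≈⟨ *-x c ⟩
        c * y + c * y′ - c * w    ≈⟨ +-cong (+-cong cy≈0 cy′≈e) (-‿cong cw≈by) ⟩
        0# + e - b * y            ≈⟨ +-congʳ (+-identityˡ e) ⟩
        e - b * y                 ∎
        where
        cw≈by : c * w ≈ b * y
        cw≈by = trans (*-w c) (*-congʳ (trans (*-congʳ cy′≈e) eb≈b))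

      c′x≈c′y : c′ * x ≈ c′ * y
      c′x≈c′y = begin
        c′ * x                      ≈⟨ *-x c′ ⟩
        c′ * y + c′ * y′ - c′ * w   ≈⟨ +-cong (+-congˡ c′y′≈0) (-‿cong (*-w≈0 c′y′≈0)) ⟩
        c′ * y + 0# - 0#            ≈⟨ x+0-0≈x (c′ * y) ⟩
        c′ * y                      ∎

      ax≈π : (b + c + c′) * x ≈ π
      ax≈π = begin
        (b + c + c′) * x                  ≈⟨ a-* x ⟩
        b * x + c * x + c′ * x            ≈⟨ +-cong (+-cong bx≈by cx≈e-by) c′x≈c′y ⟩
        b * y + (e - b * y) + c′ * y      ≈⟨ +-congʳ (x+[y-x]≈y (b * y) e) ⟩
        π                                 ∎

      ya≈e : y * (b + c + c′) ≈ e
      ya≈e = begin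
        y * (b + c + c′)          ≈⟨ *-a y ⟩
        y * b + y * c + y * c′    ≈⟨ +-cong (+-cong yb≈0 yc≈0) yc′≈e ⟩
        0# + 0# + e               ≈⟨ +-congʳ (+-identityˡ 0#) ⟩
        0# + e                    ≈⟨ +-identityˡ e ⟩
        e                         ∎

      xa≈π : x * (b + c + c′) ≈ π
      xa≈π = begin
        x * A                              ≈⟨ x-* A ⟩
        y * A + y′ * A - w * A             ≈⟨ +-cong (+-cong ya≈e y′a≈y′b+c′y) (-‿cong wa≈y′b) ⟩
        e + (y′ * b + c′ * y) - y′ * b     ≈⟨ x+[y+z]-y≈x+z e (y′ * b) (c′ * y) ⟩
        π                                  ∎
        where
        A = b + c + c′
        y′a≈y′b+c′y : y′ * A ≈ y′ * b + c′ * y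
        y′a≈y′b+c′y = begin
          y′ * A                       ≈⟨ *-a y′ ⟩
          y′ * b + y′ * c + y′ * c′    ≈⟨ +-cong (+-congˡ (sym c′y≈y′c)) y′c′≈0 ⟩
          y′ * b + c′ * y + 0#         ≈⟨ +-identityʳ _ ⟩
          y′ * b + c′ * y              ∎
        wa≈y′b : w * A ≈ y′ * b
        wa≈y′b = begin
          y′ * b * y * A      ≈⟨ *-assoc (y′ * b) y A ⟩
          y′ * b * (y * A)    ≈⟨ *-congˡ ya≈e ⟩
          y′ * b * e          ≈⟨ *-assoc y′ b e ⟩
          y′ * (b * e)        ≈⟨ *-congˡ be≈b ⟩
          y′ * b              ∎

      πa≈a : π * (b + c + c′) ≈ b + c + c′
      πa≈a = begin
        (e + c′ * y) * A                 ≈⟨ distribʳ A e (c′ * y) ⟩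
        e * A + c′ * y * A               ≈⟨ +-cong ea≈b+c (*-assoc c′ y A) ⟩
        b + c + c′ * (y * A)             ≈⟨ +-congˡ (trans (*-congˡ ya≈e) c′e≈c′) ⟩
        b + c + c′                       ∎
        where
        A = b + c + c′
        ea≈b+c : e * A ≈ b + c
        ea≈b+c = begin
          e * A                    ≈⟨ *-a e ⟩
          e * b + e * c + e * c′   ≈⟨ +-cong (+-cong eb≈b ec≈c) ec′≈0 ⟩
          b + c + 0#               ≈⟨ +-identityʳ (b + c) ⟩
          b + c                    ∎

      πx≈x : π * x ≈ x
      πx≈x = begin
        (e + c′ * y) * x          ≈⟨ distribʳ x e (c′ * y) ⟩
        e * x + c′ * y * x        ≈⟨ +-cong ex≈y (trans (*-congʳ c′y≈y′c) (*-assoc y′ c x)) ⟩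
        y + y′ * (c * x)          ≈⟨ +-congˡ (trans (*-congˡ cx≈e-by) (x[y-z]≈xy-xz y′ e (b * y))) ⟩
        y + (y′ * e - y′ * (b * y)) ≈⟨ +-congˡ (+-cong y′e≈y′ (-‿cong (sym (*-assoc y′ b y)))) ⟩
        y + (y′ - w)              ≈⟨ +-assoc y y′ (- w) ⟨
        x                         ∎
        where
        ex≈y : e * x ≈ y
        ex≈y = begin
          e * x                    ≈⟨ *-x e ⟩
          e * y + e * y′ - e * w   ≈⟨ +-cong (+-cong ey≈y ey′≈0) (-‿cong (*-w≈0 ey′≈0)) ⟩
          y + 0# - 0#              ≈⟨ x+0-0≈x y ⟩
          y                        ∎

      peirce-groupInverse : IsGroupInverseOf (b + c + c′) x
      peirce-groupInverse =
        trans (*-congʳ ax≈π) πa≈a , trans (*-congʳ xa≈π) πx≈x , trans ax≈π (sym xa≈π)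

module SignConjugation {r ℓ} (R : RingWithoutOne r ℓ) where
  open RingWithoutOne R
  open import Algebra.Properties.RingWithoutOne R using (-‿distribˡ-*; -‿distribʳ-*)
  open import Relation.Binary.Reasoning.Setoid setoid

  module _ {s : Carrier} (ss-unitʳ : ∀ m → m * (s * s) ≈ m) where
    conj : Carrier → Carrier
    conj m = s * m * s

    conj-+ : ∀ p q → conj (p + q) ≈ conj p + conj q
    conj-+ p q = trans (*-congʳ (distribˡ s p q)) (distribʳ s (s * p) (s * q))

    conj-neg : ∀ p → conj (- p) ≈ - conj p
    conj-neg p = trans (*-congʳ (sym (-‿distribʳ-* s p))) (sym (-‿distribˡ-* (s * p) s))

    conj-* : ∀ p q → conj (p * q) ≈ conj p * conj q
    conj-* p q = begin
      s * (p * q) * s            ≈⟨ *-congʳ (*-assoc s p q) ⟨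
      s * p * q * s              ≈⟨ *-congʳ (*-congʳ (*-congˡ (ss-unitʳ p))) ⟨
      s * (p * (s * s)) * q * s  ≈⟨ *-congʳ (*-congʳ reassoc) ⟩
      s * p * s * s * q * s      ≈⟨ *-congʳ (*-assoc (s * p * s) s q) ⟩
      s * p * s * (s * q) * s    ≈⟨ *-assoc (s * p * s) (s * q) s ⟩
      conj p * conj q            ∎
      where
      reassoc : s * (p * (s * s)) ≈ s * p * s * s
      reassoc = trans (*-congˡ (sym (*-assoc p s s))) (trans (sym (*-assoc s (p * s) s)) (*-congʳ (sym (*-assoc s p s))))

    conj-peirceInverse : ∀ b y y′ → conj (y + y′ - y′ * b * y) ≈ conj y + conj y′ + conj y′ * - conj b * conj y
    conj-peirceInverse b y y′ = begin
      conj (y + y′ - y′ * b * y)                     ≈⟨ conj-+ (y + y′) (- (y′ * b * y)) ⟩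
      conj (y + y′) + conj (- (y′ * b * y))           ≈⟨ +-cong (conj-+ y y′) (conj-neg (y′ * b * y)) ⟩
      conj y + conj y′ - conj (y′ * b * y)           ≈⟨ +-congˡ (-‿cong (trans (conj-* (y′ * b) y) (*-congʳ (conj-* y′ b)))) ⟩
      conj y + conj y′ - conj y′ * conj b * conj y   ≈⟨ +-congˡ (trans (-‿distribˡ-* (conj y′ * conj b) (conj y)) (*-congʳ (-‿distribʳ-* (conj y′) (conj b)))) ⟩
      conj y + conj y′ + conj y′ * - conj b * conj y ∎

module GraphProperties {n : ℕ} (G : SimpleGraph n) where
  open SimpleGraph G using (E; irrefl) renaming (sym to E-sym)
  open import Data.List.Membership.DecPropositional (Fin._≟_ {n}) using (_∈?_)
  open import Data.Parity.Base as ℙ using (Parity; 0ℙ; 1ℙ; _⁻¹)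
  open import Data.Parity.Properties using (+-homo-+; p+p≡0ℙ)
  open import Relation.Binary.PropositionalEquality using (sym; trans; cong; cong₂; subst)
  open import Data.Nat.Properties using (≤-trans; m≤n+m; m<m+n; m<n+m; +-comm; suc-injective)
  open import Data.Nat.Induction using (<-wellFounded)
  open import Data.Nat.Tactic.RingSolver using (solve-∀)
  open import Data.List.Properties using (++-assoc; length-++; length-reverse; unfold-reverse; reverse-++)
  open import Data.List.Relation.Unary.AllPairs using (AllPairs; []; _∷_)
  open import Data.List.Relation.Unary.All.Properties.Core using (¬Any⇒All¬)
  open import Data.List.Membership.Propositional.Properties using (∈-∃++)
  open import Induction.WellFounded using (Acc; acc)

  private
    V : Set
    V = Fin n

  Adj-sym : ∀ {u v} → Adj G u v → Adj G v u
  Adj-sym {u} {v} = trans (E-sym v u)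

  countF-≥1 : ∀ {m} (f : Fin m → Bool) {u} → f u ≡ true → 1 ℕ.≤ countF G f
  countF-≥1 f {zero}  fu≡true rewrite fu≡true = s≤s z≤n
  countF-≥1 f {suc u} fu≡true = ≤-trans (countF-≥1 (λ i → f (suc i)) fu≡true) (m≤n+m _ _)

  countF-≥2 : ∀ {m} (f : Fin m → Bool) {u v} → u ≢ v → f u ≡ true → f v ≡ true → 2 ℕ.≤ countF G f
  countF-≥2 f {zero}  {zero}  u≢v _ _ = ⊥-elim (u≢v refl)
  countF-≥2 f {zero}  {suc v} _ fu≡true fv≡true rewrite fu≡true = s≤s (countF-≥1 (λ i → f (suc i)) fv≡true)
  countF-≥2 f {suc u} {zero}  _ fu≡true fv≡true rewrite fv≡true = s≤s (countF-≥1 (λ i → f (suc i)) fu≡true)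
  countF-≥2 f {suc u} {suc v} u≢v fu≡true fv≡true =
    ≤-trans (countF-≥2 (λ i → f (suc i)) (λ u≡v → u≢v (cong suc u≡v)) fu≡true fv≡true) (m≤n+m _ _)

  pendant-neighbour-unique : ∀ {p u v} → Pendant G p → Adj G p u → Adj G p v → u ≡ v
  pendant-neighbour-unique {p} {u} {v} deg≡1 p~u p~v with u Fin.≟ v
  ... | yes u≡v = u≡v
  ... | no  u≢v with subst (2 ℕ.≤_) deg≡1 (countF-≥2 (E p) u≢v p~u p~v)
  ...   | s≤s ()

  Chain-++⁻ʳ : ∀ xs {ys} → Chain G (xs ++ ys) → Chain G ys
  Chain-++⁻ʳ []                     chain       = chain
  Chain-++⁻ʳ (x ∷ [])      {[]}     _           = tt
  Chain-++⁻ʳ (x ∷ [])      {y ∷ ys} (_ , chain) = chain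
  Chain-++⁻ʳ (x ∷ x′ ∷ xs)          (_ , chain) = Chain-++⁻ʳ (x′ ∷ xs) chain

  Chain-++⁻ˡ : ∀ xs {y ys} → Chain G (xs ++ y ∷ ys) → Chain G (xs ++ [ y ])
  Chain-++⁻ˡ []            _               = tt
  Chain-++⁻ˡ (x ∷ [])      (x~y , _)       = x~y , tt
  Chain-++⁻ˡ (x ∷ x′ ∷ xs) (x~x′ , chain)  = x~x′ , Chain-++⁻ˡ (x′ ∷ xs) chain

  Chain-++⁺ : ∀ xs {y ys} → Chain G (xs ++ [ y ]) → Chain G (y ∷ ys) → Chain G (xs ++ y ∷ ys)
  Chain-++⁺ []            _              chain = chain
  Chain-++⁺ (x ∷ [])      (x~y , _)      chain = x~y , chain
  Chain-++⁺ (x ∷ x′ ∷ xs) (x~x′ , chain) chain′ = x~x′ , Chain-++⁺ (x′ ∷ xs) chain chain′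

  Chain-reverse : ∀ xs → Chain G xs → Chain G (reverse xs)
  Chain-reverse []                   _             = tt
  Chain-reverse (x ∷ [])             _             = tt
  Chain-reverse (x ∷ yys@(y ∷ ys)) (x~y , chain) =
    subst (Chain G) (sym (reverse-xyys x y ys))
      (Chain-++⁺ (reverse ys) (subst (Chain G) (unfold-reverse y ys) (Chain-reverse yys chain)) (Adj-sym x~y , tt))
    where
    reverse-xyys : ∀ (x y : V) ys → reverse (x ∷ y ∷ ys) ≡ reverse ys ++ y ∷ [ x ]
    reverse-xyys x y ys = begin
      reverse (x ∷ y ∷ ys)            ≡⟨ unfold-reverse x (y ∷ ys) ⟩
      reverse (y ∷ ys) ++ [ x ]       ≡⟨ cong (_++ [ x ]) (unfold-reverse y ys) ⟩
      (reverse ys ++ [ y ]) ++ [ x ]  ≡⟨ ++-assoc (reverse ys) [ y ] [ x ] ⟩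
      reverse ys ++ y ∷ [ x ]         ∎
      where open ≡-Reasoning

  ClosedWalk : List V → Set
  ClosedWalk []       = ⊥
  ClosedWalk (x ∷ xs) = Chain G (x ∷ xs ++ [ x ])

  HasCycle : Set
  HasCycle = ∃ λ v₀ → ∃ λ xs → ∃ λ vₖ → IsCycle G v₀ xs vₖ

  ClosedWalk-split : ∀ a u b c → ClosedWalk (a ++ u ∷ b ++ u ∷ c) → ClosedWalk (u ∷ b) × ClosedWalk (a ++ u ∷ c)
  ClosedWalk-split [] u b c walk = Chain-++⁻ˡ (u ∷ b) walk′ , Chain-++⁻ʳ (u ∷ b) walk′
    where
    walk′ : Chain G ((u ∷ b) ++ u ∷ c ++ [ u ])
    walk′ = subst (λ l → Chain G (u ∷ l)) (++-assoc b (u ∷ c) [ u ]) walk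
  ClosedWalk-split (x ∷ a) u b c walk =
    Chain-++⁻ˡ (u ∷ b) (Chain-++⁻ʳ (x ∷ a) walk′) ,
    subst (Chain G) (cong (x ∷_) (sym (++-assoc a (u ∷ c) [ x ])))
      (Chain-++⁺ (x ∷ a) (Chain-++⁻ˡ (x ∷ a) walk′) (Chain-++⁻ʳ (u ∷ b) (Chain-++⁻ʳ (x ∷ a) walk′)))
    where
    walk′ : Chain G ((x ∷ a) ++ u ∷ b ++ u ∷ c ++ [ x ])
    walk′ = subst (λ l → Chain G (x ∷ l))
              (trans (++-assoc a _ [ x ]) (cong (λ l → a ++ u ∷ l) (++-assoc b (u ∷ c) [ x ]))) walk

  Duplicate : List V → Set
  Duplicate xs = ∃ λ a → ∃ λ u → ∃ λ b → ∃ λ c → xs ≡ a ++ u ∷ b ++ u ∷ c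

  unique⊎duplicate : ∀ xs → AllPairs _≢_ xs ⊎ Duplicate xs
  unique⊎duplicate []       = inj₁ []
  unique⊎duplicate (x ∷ xs) with x ∈? xs
  ... | yes x∈xs with b , c , xs≡b++x∷c ← ∈-∃++ x∈xs = inj₂ ([] , x , b , c , cong (x ∷_) xs≡b++x∷c)
  ... | no  x∉xs with unique⊎duplicate xs
  ...   | inj₁ unique = inj₁ (¬Any⇒All¬ xs x∉xs ∷ unique)
  ...   | inj₂ (a , u , b , c , xs≡) = inj₂ (x ∷ a , u , b , c , cong (x ∷_) xs≡)

  length-split : ∀ a (u : V) b c → length (a ++ u ∷ b ++ u ∷ c) ≡ length (u ∷ b) ℕ.+ length (a ++ u ∷ c)
  length-split a u b c = begin
    length (a ++ u ∷ b ++ u ∷ c)                             ≡⟨ length-++ a ⟩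
    length a ℕ.+ suc (length (b ++ u ∷ c))                   ≡⟨ cong (λ k → length a ℕ.+ suc k) (length-++ b) ⟩
    length a ℕ.+ suc (length b ℕ.+ suc (length c))           ≡⟨ reorder (length a) (length b) (length c) ⟩
    suc (length b) ℕ.+ (length a ℕ.+ suc (length c))         ≡⟨ cong (suc (length b) ℕ.+_) (length-++ a) ⟨
    length (u ∷ b) ℕ.+ length (a ++ u ∷ c)                   ∎
    where
    open ≡-Reasoning
    reorder : ∀ x y z → x ℕ.+ suc (y ℕ.+ suc z) ≡ suc y ℕ.+ (x ℕ.+ suc z)
    reorder = solve-∀

  odd-summand : ∀ p q → p ℙ.+ q ≡ 1ℙ → p ≡ 1ℙ ⊎ q ≡ 1ℙ
  odd-summand 0ℙ q q≡1 = inj₂ q≡1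
  odd-summand 1ℙ q _   = inj₁ refl

  uniqueOddClosedWalk⇒cycle : ∀ xs → AllPairs _≢_ xs → ClosedWalk xs → ℕ.parity (length xs) ≡ 1ℙ → HasCycle
  uniqueOddClosedWalk⇒cycle (x ∷ [])         _      (x~x , _) _ = ⊥-elim (true≢false (trans (sym x~x) (irrefl x)))
    where
    true≢false : true ≢ false
    true≢false ()
  uniqueOddClosedWalk⇒cycle (x ∷ y ∷ zs) unique walk odd with initLast zs
  uniqueOddClosedWalk⇒cycle (x ∷ y ∷ .[])       _ _ () | []
  uniqueOddClosedWalk⇒cycle (x ∷ y ∷ .(ys ∷ʳ w)) unique walk _ | ys ∷ʳ′ w =
    x , y ∷ ys , w , s≤s z≤n , unique , Chain-++⁻ˡ (x ∷ y ∷ ys) walk′ , proj₁ (Chain-++⁻ʳ (x ∷ y ∷ ys) walk′)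
    where
    walk′ : Chain G ((x ∷ y ∷ ys) ++ w ∷ [ x ])
    walk′ = subst (λ l → Chain G (x ∷ y ∷ l)) (++-assoc ys [ w ] [ x ]) walk

  oddClosedWalk⇒cycle′ : ∀ xs → Acc ℕ._<_ (length xs) → ClosedWalk xs → ℕ.parity (length xs) ≡ 1ℙ → HasCycle
  oddClosedWalk⇒cycle′ xs (acc shorter) walk odd with unique⊎duplicate xs
  ... | inj₁ unique = uniqueOddClosedWalk⇒cycle xs unique walk odd
  ... | inj₂ (a , u , b , c , refl) =
    recurse (ClosedWalk-split a u b c walk) (odd-summand _ _ (trans (sym (+-homo-+ ∣u∷b∣ ∣a++u∷c∣)) odd′))
    where
    ∣u∷b∣ ∣a++u∷c∣ : ℕ
    ∣u∷b∣    = length (u ∷ b)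
    ∣a++u∷c∣ = length (a ++ u ∷ c)
    split : length (a ++ u ∷ b ++ u ∷ c) ≡ ∣u∷b∣ ℕ.+ ∣a++u∷c∣
    split = length-split a u b c
    odd′ : ℕ.parity (∣u∷b∣ ℕ.+ ∣a++u∷c∣) ≡ 1ℙ
    odd′ = subst (λ k → ℕ.parity k ≡ 1ℙ) split odd
    nonempty : ∀ (a : List V) → 0 ℕ.< length (a ++ u ∷ c)
    nonempty []      = s≤s z≤n
    nonempty (_ ∷ _) = s≤s z≤n
    recurse : ClosedWalk (u ∷ b) × ClosedWalk (a ++ u ∷ c) →
              ℕ.parity ∣u∷b∣ ≡ 1ℙ ⊎ ℕ.parity ∣a++u∷c∣ ≡ 1ℙ → HasCycle
    recurse (walk₁ , _) (inj₁ odd₁) =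
      oddClosedWalk⇒cycle′ (u ∷ b) (shorter (subst (∣u∷b∣ ℕ.<_) (sym split) (m<m+n ∣u∷b∣ (nonempty a)))) walk₁ odd₁
    recurse (_ , walk₂) (inj₂ odd₂) =
      oddClosedWalk⇒cycle′ (a ++ u ∷ c) (shorter (subst (∣a++u∷c∣ ℕ.<_) (sym split) (m<n+m ∣a++u∷c∣ (s≤s z≤n)))) walk₂ odd₂

  oddClosedWalk⇒cycle : ∀ xs → ClosedWalk xs → ℕ.parity (length xs) ≡ 1ℙ → HasCycle
  oddClosedWalk⇒cycle xs = oddClosedWalk⇒cycle′ xs (<-wellFounded (length xs))

  Acyclic⇒¬HasCycle : Acyclic G → ¬ HasCycle
  Acyclic⇒¬HasCycle acyclic (v₀ , xs , vₖ , cycle) = acyclic v₀ xs vₖ cycle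

  p≢q⇒q≡p⁻¹ : ∀ {p q} → p ≢ q → q ≡ p ⁻¹
  p≢q⇒q≡p⁻¹ {0ℙ} {0ℙ} p≢q = ⊥-elim (p≢q refl)
  p≢q⇒q≡p⁻¹ {0ℙ} {1ℙ} _   = refl
  p≢q⇒q≡p⁻¹ {1ℙ} {0ℙ} _   = refl
  p≢q⇒q≡p⁻¹ {1ℙ} {1ℙ} p≢q = ⊥-elim (p≢q refl)

  -- Colour v by the parity of the length of some path from v to a root r: adjacent
  -- vertices of equal colour would close an odd walk through r, hence a cycle.
  module RootColouring (connected : Connected G) (acyclic : Acyclic G) (r : V) where

    PathToRoot : V → Set
    PathToRoot v = ∃ λ ps → Chain G (ps ++ [ r ]) × ∃ λ qs → ps ++ [ r ] ≡ v ∷ qs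

    pathToRoot : ∀ v → PathToRoot v
    pathToRoot v with v Fin.≟ r
    ... | yes refl = [] , tt , [] , refl
    ... | no v≢r with xs , chain ← connected v r v≢r = v ∷ xs , chain , xs ++ [ r ] , refl

    closedWalkThroughRoot : ∀ {u v} → Adj G u v → ((ps , _) : PathToRoot u) ((ps′ , _) : PathToRoot v) →
                            ∃ λ xs → ClosedWalk xs × ℕ.parity (length xs) ≡ (ℕ.parity (length ps) ℙ.+ ℕ.parity (length ps′)) ⁻¹
    closedWalkThroughRoot {u} {v} u~v (ps , chainᵤ , qs , ps++r≡u∷qs) (ps′ , chainᵥ , qs′ , ps′++r≡v∷qs′) =
      u ∷ qs ++ reverse ps′ , subst (Chain G) rearrange (Chain-++⁺ ps chainᵤ r→v→u) , parity≡
      where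
      open ≡-Reasoning
      r→v→u : Chain G (r ∷ reverse ps′ ++ [ u ])
      r→v→u = subst (Chain G) reverse-u∷ps′++r
                (Chain-reverse (u ∷ ps′ ++ [ r ]) (subst (λ l → Chain G (u ∷ l)) (sym ps′++r≡v∷qs′)
                  (u~v , subst (Chain G) ps′++r≡v∷qs′ chainᵥ)))
        where
        reverse-u∷ps′++r : reverse (u ∷ ps′ ++ [ r ]) ≡ r ∷ reverse ps′ ++ [ u ]
        reverse-u∷ps′++r = begin
          reverse (u ∷ ps′ ++ [ r ])        ≡⟨ unfold-reverse u (ps′ ++ [ r ]) ⟩
          reverse (ps′ ++ [ r ]) ++ [ u ]   ≡⟨ cong (_++ [ u ]) (reverse-++ ps′ [ r ]) ⟩
          r ∷ reverse ps′ ++ [ u ]          ∎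
      rearrange : ps ++ r ∷ reverse ps′ ++ [ u ] ≡ u ∷ (qs ++ reverse ps′) ++ [ u ]
      rearrange = begin
        ps ++ r ∷ reverse ps′ ++ [ u ]          ≡⟨ ++-assoc ps [ r ] _ ⟨
        (ps ++ [ r ]) ++ reverse ps′ ++ [ u ]   ≡⟨ cong (_++ reverse ps′ ++ [ u ]) ps++r≡u∷qs ⟩
        u ∷ qs ++ reverse ps′ ++ [ u ]          ≡⟨ cong (u ∷_) (++-assoc qs (reverse ps′) [ u ]) ⟨
        u ∷ (qs ++ reverse ps′) ++ [ u ]        ∎
      ∣qs∣≡∣ps∣ : length qs ≡ length ps
      ∣qs∣≡∣ps∣ = suc-injective (begin
        suc (length qs)         ≡⟨ cong length ps++r≡u∷qs ⟨
        length (ps ++ [ r ])    ≡⟨ length-++ ps ⟩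
        length ps ℕ.+ 1         ≡⟨ +-comm (length ps) 1 ⟩
        suc (length ps)         ∎)
      parity≡ : ℕ.parity (length (u ∷ qs ++ reverse ps′)) ≡ (ℕ.parity (length ps) ℙ.+ ℕ.parity (length ps′)) ⁻¹
      parity≡ = begin
        ℕ.parity (1 ℕ.+ length (qs ++ reverse ps′))                   ≡⟨ +-homo-+ 1 (length (qs ++ reverse ps′)) ⟩
        ℕ.parity (length (qs ++ reverse ps′)) ⁻¹                      ≡⟨ cong (λ k → ℕ.parity k ⁻¹) (length-++ qs) ⟩
        ℕ.parity (length qs ℕ.+ length (reverse ps′)) ⁻¹              ≡⟨ cong _⁻¹ (+-homo-+ (length qs) (length (reverse ps′))) ⟩
        (ℕ.parity (length qs) ℙ.+ ℕ.parity (length (reverse ps′))) ⁻¹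
          ≡⟨ cong₂ (λ k l → (ℕ.parity k ℙ.+ ℕ.parity l) ⁻¹) ∣qs∣≡∣ps∣ (length-reverse ps′) ⟩
        (ℕ.parity (length ps) ℙ.+ ℕ.parity (length ps′)) ⁻¹          ∎

    colour : V → Parity
    colour v = ℕ.parity (length (proj₁ (pathToRoot v)))

    colour-proper : ∀ {u v} → Adj G u v → colour v ≡ colour u ⁻¹
    colour-proper {u} {v} u~v with closedWalkThroughRoot u~v (pathToRoot u) (pathToRoot v)
    ... | xs , walk , parity≡ = p≢q⇒q≡p⁻¹ λ same →
      Acyclic⇒¬HasCycle acyclic (oddClosedWalk⇒cycle xs walk (trans parity≡ (cong _⁻¹ (begin
        colour u ℙ.+ colour v   ≡⟨ cong (ℙ._+ colour v) same ⟩
        colour v ℙ.+ colour v   ≡⟨ p+p≡0ℙ (colour v) ⟩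
        0ℙ                      ∎))))
      where open ≡-Reasoning

  -- p and q would be each other's only neighbours, so no path could leave {p, q}
  pendants-nonadjacent : Connected G → ∀ {r} → ¬ Pendant G r →
                         ∀ {p q} → Pendant G p → Pendant G q → ¬ Adj G p q
  pendants-nonadjacent connected {r} r-core {p} {q} p-pendant q-pendant p~q = r-core (pendant (r∈pq))
    where
    _∈pq : V → Set
    x ∈pq = x ≡ p ⊎ x ≡ q
    step : ∀ {x y} → x ∈pq → Adj G x y → y ∈pq
    step (inj₁ refl) x~y = inj₂ (pendant-neighbour-unique p-pendant x~y p~q)
    step (inj₂ refl) x~y = inj₁ (pendant-neighbour-unique q-pendant x~y (Adj-sym p~q))
    follow : ∀ {x} xs → x ∈pq → Chain G (x ∷ xs ++ [ r ]) → r ∈pq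
    follow []       x∈pq (x~r , _)     = step x∈pq x~r
    follow (y ∷ ys) x∈pq (x~y , chain) = follow ys (step x∈pq x~y) chain
    r∈pq : r ∈pq
    r∈pq with p Fin.≟ r
    ... | yes refl = inj₁ refl
    ... | no  p≢r with xs , chain ← connected p r p≢r = follow xs (inj₁ refl) chain
    pendant : r ∈pq → Pendant G r
    pendant (inj₁ refl) = p-pendant
    pendant (inj₂ refl) = q-pendant

module PendantTree (F : OrderedField) {n : ℕ} (G : SimpleGraph n) (w : Matrices.Matrix F n)
                   (w-pos : Matrices.PositiveWeights F G w)
                   (connected : Connected G) (acyclic : Acyclic G)
                   (r : Fin n) (r-core : ¬ Pendant G r)
                   (pendant-neighbour : ∀ v → ¬ Pendant G v → ∃ λ u → Adj G v u × Pendant G u) where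
  open OrderedField F renaming (_⁻¹ to _⁻¹ᶠ)
  open OrderedFieldProperties F
  open ParitySign F
  open SumProperties F
  open Matrices F
  open MatrixRing F
  open GraphProperties G
  open import Data.Parity.Base using (Parity; _⁻¹)
  open import Data.Parity.Properties using (⁻¹-involutive)
  open import Relation.Binary.PropositionalEquality using (sym; trans; cong; cong₂; subst; subst₂)

  ℳ : RingWithoutOne 0ℓ 0ℓ
  ℳ = matrixRing n

  open RingWithoutOne ℳ using () renaming (setoid to ℳ-setoid; *-semigroup to ℳ-*-semigroup)
  import Relation.Binary.Reasoning.Setoid ℳ-setoid as ℳ-Reasoning
  open PeirceGroupInverse ℳ using (module PeirceBlocks; module PeirceInverse)
  open SignConjugation ℳ using (conj-peirceInverse)
  open GroupInverse ℳ-*-semigroup using (groupInverse-resp; groupInverse-unique)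

  A : Matrix n
  A = adjacency G w

  A-support : ∀ i j → A i j ≡ 0# ⊎ Adj G i j
  A-support i j with SimpleGraph.E G i j
  ... | true  = inj₂ refl
  ... | false = inj₁ refl

  A-on-edge : ∀ {i j} → Adj G i j → A i j ≡ w i j
  A-on-edge i~j = cong (if_then _ else 0#) i~j

  A-nonneg : NonNegative A
  A-nonneg i j with SimpleGraph.E G i j in i~j
  ... | true  = proj₁ (w-pos i j i~j)
  ... | false = ≤-refl

  w-nonzero : ∀ {i j} → Adj G i j → w i j ≢ 0#
  w-nonzero i~j w≡0 = proj₂ (w-pos _ _ i~j) (sym w≡0)

  -- opaque, so that `with pendant? v` also abstracts `pendant v` in goals
  opaque
    pendant? : ∀ v → Dec (Pendant G v)
    pendant? v = degree G v ℕ.≟ 1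

  pendant core : Fin n → Bool
  pendant v = does (pendant? v)
  core    v = not (pendant v)

  ιᶜ ιᵖ : Fin n → Carrier
  ιᶜ = ι ∘ core
  ιᵖ = ι ∘ pendant

  πᶜ πᵖ : Matrix n
  πᶜ = diag ιᶜ
  πᵖ = diag ιᵖ

  πᶜ-idem : πᶜ · πᶜ ≐ πᶜ
  πᶜ-idem i j = trans (diag-·-diag ιᶜ ιᶜ i j) (diag-cong (ι-idem ∘ core) i j)

  πᵖ-idem : πᵖ · πᵖ ≐ πᵖ
  πᵖ-idem i j = trans (diag-·-diag ιᵖ ιᵖ i j) (diag-cong (ι-idem ∘ pendant) i j)

  πᶜπᵖ≐0 : πᶜ · πᵖ ≐ 0ᴹ
  πᶜπᵖ≐0 i j = trans (diag-·-diag ιᶜ ιᵖ i j) (trans (diag-cong (ι-orthˡ ∘ pendant) i j) (diag-zero i j))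

  πᵖπᶜ≐0 : πᵖ · πᶜ ≐ 0ᴹ
  πᵖπᶜ≐0 i j = trans (diag-·-diag ιᵖ ιᶜ i j) (trans (diag-cong (ι-orthʳ ∘ pendant) i j) (diag-zero i j))

  open PeirceBlocks πᶜ πᵖ A

  block-nonneg : ∀ p q → NonNegative (diag (ι ∘ p) · A · diag (ι ∘ q))
  block-nonneg p q i j = subst (0# ≤_) (sym (diag-·-·-diag (ι ∘ p) A (ι ∘ q) i j))
                           (*-nonneg (*-nonneg (ι-nonneg (p i)) (A-nonneg i j)) (ι-nonneg (q j)))

  b-nonneg : NonNegative b
  b-nonneg = block-nonneg core core

  c-nonneg : NonNegative c
  c-nonneg = block-nonneg core pendant

  c′-nonneg : NonNegative c′
  c′-nonneg = block-nonneg pendant core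

  core-core-entry : ∀ i j → ιᶜ i * A i j * ιᶜ j ≡ 0# ⊎ (¬ Pendant G i × ¬ Pendant G j × Adj G i j)
  core-core-entry i j with pendant? i | pendant? j | A-support i j
  ... | yes _     | _         | _        = inj₁ (0*y*z≡0 _ _)
  ... | no _      | yes _     | _        = inj₁ (x*y*0≡0 _ _)
  ... | no _      | no _      | inj₁ A≡0 = inj₁ (y≡0⇒x*y*z≡0 _ _ A≡0)
  ... | no i-core | no j-core | inj₂ i~j = inj₂ (i-core , j-core , i~j)

  core-pendant-entry : ∀ i j → ιᶜ i * A i j * ιᵖ j ≡ 0# ⊎ (¬ Pendant G i × Pendant G j × Adj G i j)
  core-pendant-entry i j with pendant? i | pendant? j | A-support i j
  ... | yes _     | _          | _        = inj₁ (0*y*z≡0 _ _)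
  ... | no _      | no _       | _        = inj₁ (x*y*0≡0 _ _)
  ... | no _      | yes _      | inj₁ A≡0 = inj₁ (y≡0⇒x*y*z≡0 _ _ A≡0)
  ... | no i-core | yes j-pend | inj₂ i~j = inj₂ (i-core , j-pend , i~j)

  pendant-core-entry : ∀ i j → ιᵖ i * A i j * ιᶜ j ≡ 0# ⊎ (Pendant G i × ¬ Pendant G j × Adj G i j)
  pendant-core-entry i j with pendant? i | pendant? j | A-support i j
  ... | no _       | _         | _        = inj₁ (0*y*z≡0 _ _)
  ... | yes _      | yes _     | _        = inj₁ (x*y*0≡0 _ _)
  ... | yes _      | no _      | inj₁ A≡0 = inj₁ (y≡0⇒x*y*z≡0 _ _ A≡0)
  ... | yes i-pend | no j-core | inj₂ i~j = inj₂ (i-pend , j-core , i~j)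

  pendant-pendant-entry : ∀ i j → ιᵖ i * A i j * ιᵖ j ≡ 0#
  pendant-pendant-entry i j with pendant? i | pendant? j | A-support i j
  ... | no _       | _          | _        = 0*y*z≡0 _ _
  ... | yes _      | no _       | _        = x*y*0≡0 _ _
  ... | yes _      | yes _      | inj₁ A≡0 = y≡0⇒x*y*z≡0 _ _ A≡0
  ... | yes i-pend | yes j-pend | inj₂ i~j = ⊥-elim (pendants-nonadjacent connected r-core i-pend j-pend i~j)

  A≐b+c+c′ : A ≐ b +ᴹ c +ᴹ c′
  A≐b+c+c′ i j = begin
    A i j                                    ≡⟨ 1*x*1≡x (A i j) ⟨
    1# * A i j * 1#                          ≡⟨ cong₂ (λ u v → u * A i j * v) (ι-compl (pendant i)) (ι-compl (pendant j)) ⟨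
    (ιᶜ i + ιᵖ i) * A i j * (ιᶜ j + ιᵖ j)    ≡⟨ expand (ιᶜ i) (ιᵖ i) (A i j) (ιᶜ j) (ιᵖ j) ⟩
    bᵢⱼ + cᵢⱼ + c′ᵢⱼ + ιᵖ i * A i j * ιᵖ j   ≡⟨ cong (bᵢⱼ + cᵢⱼ + c′ᵢⱼ +_) (pendant-pendant-entry i j) ⟩
    bᵢⱼ + cᵢⱼ + c′ᵢⱼ + 0#                    ≡⟨ +-identityʳ _ ⟩
    bᵢⱼ + cᵢⱼ + c′ᵢⱼ                         ≡⟨ cong₂ _+_ (cong₂ _+_ (diag-·-·-diag ιᶜ A ιᶜ i j) (diag-·-·-diag ιᶜ A ιᵖ i j))
                                                          (diag-·-·-diag ιᵖ A ιᶜ i j) ⟨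
    (b +ᴹ c +ᴹ c′) i j                       ∎
    where
    open ≡-Reasoning
    bᵢⱼ cᵢⱼ c′ᵢⱼ : Carrier
    bᵢⱼ  = ιᶜ i * A i j * ιᶜ j
    cᵢⱼ  = ιᶜ i * A i j * ιᵖ j
    c′ᵢⱼ = ιᵖ i * A i j * ιᶜ j
    expand : ∀ e f x e′ f′ → (e + f) * x * (e′ + f′) ≡ e * x * e′ + e * x * f′ + f * x * e′ + f * x * f′
    expand = solve 5 (λ e f x e′ f′ → ((e ⊕ f) ⊗ x ⊗ (e′ ⊕ f′)) ⊜ (e ⊗ x ⊗ e′ ⊕ e ⊗ x ⊗ f′ ⊕ f ⊗ x ⊗ e′ ⊕ f ⊗ x ⊗ f′)) refl

  b-support : ∀ i j → b i j ≡ 0# ⊎ (¬ Pendant G i × ¬ Pendant G j × Adj G i j)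
  b-support i j = Data.Sum.map₁ (trans (diag-·-·-diag ιᶜ A ιᶜ i j)) (core-core-entry i j)

  c-support : ∀ i j → c i j ≡ 0# ⊎ (¬ Pendant G i × Pendant G j × Adj G i j)
  c-support i j = Data.Sum.map₁ (trans (diag-·-·-diag ιᶜ A ιᵖ i j)) (core-pendant-entry i j)

  c′-support : ∀ i j → c′ i j ≡ 0# ⊎ (Pendant G i × ¬ Pendant G j × Adj G i j)
  c′-support i j = Data.Sum.map₁ (trans (diag-·-·-diag ιᵖ A ιᶜ i j)) (pendant-core-entry i j)

  c-on-edge : ∀ {i j} → ¬ Pendant G i → Pendant G j → Adj G i j → c i j ≡ w i j
  c-on-edge {i} {j} i-core j-pend i~j = trans (diag-·-·-diag ιᶜ A ιᵖ i j) entry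
    where
    entry : ιᶜ i * A i j * ιᵖ j ≡ w i j
    entry with pendant? i | pendant? j
    ... | yes i-pend | _         = ⊥-elim (i-core i-pend)
    ... | no _       | no j-core = ⊥-elim (j-core j-pend)
    ... | no _       | yes _     = trans (1*x*1≡x (A i j)) (A-on-edge i~j)

  c′-on-edge : ∀ {i j} → Pendant G i → ¬ Pendant G j → Adj G i j → c′ i j ≡ w i j
  c′-on-edge {i} {j} i-pend j-core i~j = trans (diag-·-·-diag ιᵖ A ιᶜ i j) entry
    where
    entry : ιᵖ i * A i j * ιᶜ j ≡ w i j
    entry with pendant? i | pendant? j
    ... | no i-core | _          = ⊥-elim (i-core i-pend)
    ... | yes _     | yes j-pend = ⊥-elim (j-core j-pend)
    ... | yes _     | no _       = trans (1*x*1≡x (A i j)) (A-on-edge i~j)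

  δ : Fin n → Carrier
  δ i = (c · c′) i i

  -- distinct core vertices share no pendant neighbour
  cc′-diagonal : c · c′ ≐ diag δ
  cc′-diagonal = diagonal (c · c′) λ i j i≢j → sumF-zero (term≡0 i≢j)
    where
    term≡0 : ∀ {i j} → i ≢ j → ∀ k → c i k * c′ k j ≡ 0#
    term≡0 {i} {j} i≢j k with c-support i k | c′-support k j
    ... | inj₁ c≡0 | _         = trans (cong (_* c′ k j) c≡0) (zeroˡ _)
    ... | inj₂ _   | inj₁ c′≡0 = trans (cong (c i k *_) c′≡0) (zeroʳ _)
    ... | inj₂ (_ , k-pend , i~k) | inj₂ (_ , _ , k~j) =
      ⊥-elim (i≢j (pendant-neighbour-unique k-pend (Adj-sym i~k) k~j))

  δ-nonneg : ∀ i → 0# ≤ δ i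
  δ-nonneg i = sumF-nonneg λ k → *-nonneg (c-nonneg i k) (c′-nonneg k i)

  δ-nonzero : ∀ {i} → ¬ Pendant G i → δ i ≢ 0#
  δ-nonzero {i} i-core with pendant-neighbour i i-core
  ... | u , i~u , u-pend =
    sumF-nonzero (λ k → *-nonneg (c-nonneg i k) (c′-nonneg k i)) u
      (subst₂ (λ cᵢᵤ c′ᵤᵢ → cᵢᵤ * c′ᵤᵢ ≢ 0#) (sym (c-on-edge i-core u-pend i~u)) (sym (c′-on-edge u-pend i-core u~i))
        (*-nonzero (w-nonzero i~u) (w-nonzero u~i)))
    where
    u~i = Adj-sym i~u

  δ⁺ : ∀ i → Dec (Pendant G i) → Carrier
  δ⁺ i (yes _)      = 0#
  δ⁺ i (no  i-core) = (δ i ⁻¹ᶠ) (δ-nonzero i-core)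

  d⁺ : Fin n → Carrier
  d⁺ i = δ⁺ i (pendant? i)

  d⁺-nonneg : ∀ i → 0# ≤ d⁺ i
  d⁺-nonneg i = go (pendant? i)
    where
    go : (p : Dec (Pendant G i)) → 0# ≤ δ⁺ i p
    go (yes _)      = ≤-refl
    go (no  i-core) = ⁻¹-nonneg (δ-nonzero i-core) (δ-nonneg i)

  δd⁺≡ιᶜ : ∀ i → δ i * d⁺ i ≡ ιᶜ i
  δd⁺≡ιᶜ i = go (pendant? i)
    where
    go : (p : Dec (Pendant G i)) → δ i * δ⁺ i p ≡ ι (not (does p))
    go (yes _)      = zeroʳ (δ i)
    go (no  i-core) = inverse (δ i) (δ-nonzero i-core)

  ιᶜd⁺≡d⁺ : ∀ i → ιᶜ i * d⁺ i ≡ d⁺ i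
  ιᶜd⁺≡d⁺ i = go (pendant? i)
    where
    go : (p : Dec (Pendant G i)) → ι (not (does p)) * δ⁺ i p ≡ δ⁺ i p
    go (yes _) = zeroˡ 0#
    go (no  _) = *-identityˡ _

  D⁺ : Matrix n
  D⁺ = diag d⁺

  πᶜD⁺≐D⁺ : πᶜ · D⁺ ≐ D⁺
  πᶜD⁺≐D⁺ i j = trans (diag-·-diag ιᶜ d⁺ i j) (diag-cong ιᶜd⁺≡d⁺ i j)

  D⁺πᶜ≐D⁺ : D⁺ · πᶜ ≐ D⁺
  D⁺πᶜ≐D⁺ i j = trans (diag-·-diag d⁺ ιᶜ i j) (diag-cong (λ k → trans (*-comm (d⁺ k) (ιᶜ k)) (ιᶜd⁺≡d⁺ k)) i j)

  open PeirceInverse πᶜ πᵖ A D⁺ using (y; y′; peirce-groupInverse)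
  open PeirceInverse πᶜ πᵖ A D⁺ public using (x)

  cy′≐πᶜ : c · y′ ≐ πᶜ
  cy′≐πᶜ = begin
    c · (c′ · D⁺)            ≈⟨ ·-assoc c c′ D⁺ ⟨
    c · c′ · D⁺              ≈⟨ ·-cong cc′-diagonal (λ _ _ → refl) ⟩
    diag δ · D⁺              ≈⟨ diag-·-diag δ d⁺ ⟩
    diag (λ i → δ i * d⁺ i)  ≈⟨ diag-cong δd⁺≡ιᶜ ⟩
    πᶜ                       ∎
    where open ℳ-Reasoning

  yc′≐πᶜ : y · c′ ≐ πᶜ
  yc′≐πᶜ = begin
    D⁺ · c · c′              ≈⟨ ·-assoc D⁺ c c′ ⟩
    D⁺ · (c · c′)            ≈⟨ ·-cong (λ _ _ → refl) cc′-diagonal ⟩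
    D⁺ · diag δ              ≈⟨ diag-·-diag d⁺ δ ⟩
    diag (λ i → d⁺ i * δ i)  ≈⟨ diag-cong (λ i → trans (*-comm (d⁺ i) (δ i)) (δd⁺≡ιᶜ i)) ⟩
    πᶜ                       ∎
    where open ℳ-Reasoning

  groupInverse : IsGroupInverse A x
  groupInverse = groupInverse-resp A≐b+c+c′
    (peirce-groupInverse πᶜ-idem πᵖ-idem πᶜπᵖ≐0 πᵖπᶜ≐0 πᶜD⁺≐D⁺ D⁺πᶜ≐D⁺ cy′≐πᶜ yc′≐πᶜ)

  y-nonneg : NonNegative y
  y-nonneg i j = subst (0# ≤_) (sym (diag-· d⁺ c i j)) (*-nonneg (d⁺-nonneg i) (c-nonneg i j))

  y′-nonneg : NonNegative y′
  y′-nonneg i j = subst (0# ≤_) (sym (·-diag c′ d⁺ i j)) (*-nonneg (c′-nonneg i j) (d⁺-nonneg j))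

  colour : Fin n → Parity
  colour = RootColouring.colour connected acyclic r

  colour-proper : ∀ {u v} → Adj G u v → colour v ≡ colour u ⁻¹
  colour-proper = RootColouring.colour-proper connected acyclic r

  -- flipping the colour of pendant vertices makes every core–pendant edge monochromatic
  label : Fin n → Parity
  label v = if pendant v then colour v ⁻¹ else colour v

  label-core-pendant : ∀ {i j} → ¬ Pendant G i → Pendant G j → Adj G i j → label j ≡ label i
  label-core-pendant {i} {j} i-core j-pend i~j with pendant? i | pendant? j
  ... | yes i-pend | _         = ⊥-elim (i-core i-pend)
  ... | no _       | no j-core = ⊥-elim (j-core j-pend)
  ... | no _       | yes _     = trans (cong _⁻¹ (colour-proper i~j)) (⁻¹-involutive (colour i))

  label-pendant-core : ∀ {i j} → Pendant G i → ¬ Pendant G j → Adj G i j → label j ≡ label i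
  label-pendant-core {i} {j} i-pend j-core i~j with pendant? i | pendant? j
  ... | no i-core | _          = ⊥-elim (i-core i-pend)
  ... | yes _     | yes j-pend = ⊥-elim (j-core j-pend)
  ... | yes _     | no _       = colour-proper i~j

  label-core-core : ∀ {i j} → ¬ Pendant G i → ¬ Pendant G j → Adj G i j → label j ≡ label i ⁻¹
  label-core-core {i} {j} i-core j-core i~j with pendant? i | pendant? j
  ... | yes i-pend | _          = ⊥-elim (i-core i-pend)
  ... | no _       | yes j-pend = ⊥-elim (j-core j-pend)
  ... | no _       | no _       = colour-proper i~j

  y-labels : ∀ i j → y i j ≡ 0# ⊎ label j ≡ label i
  y-labels i j with c-support i j
  ... | inj₁ c≡0 = inj₁ (trans (diag-· d⁺ c i j) (trans (cong (d⁺ i *_) c≡0) (zeroʳ (d⁺ i))))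
  ... | inj₂ (i-core , j-pend , i~j) = inj₂ (label-core-pendant i-core j-pend i~j)

  y′-labels : ∀ i j → y′ i j ≡ 0# ⊎ label j ≡ label i
  y′-labels i j with c′-support i j
  ... | inj₁ c′≡0 = inj₁ (trans (·-diag c′ d⁺ i j) (trans (cong (_* d⁺ j) c′≡0) (zeroˡ (d⁺ j))))
  ... | inj₂ (i-pend , j-core , i~j) = inj₂ (label-pendant-core i-pend j-core i~j)

  b-labels : ∀ i j → b i j ≡ 0# ⊎ label j ≡ label i ⁻¹
  b-labels i j = Data.Sum.map₂ (λ (i-core , j-core , i~j) → label-core-core i-core j-core i~j) (b-support i j)

  s : Fin n → Carrier
  s = sign ∘ label

  S : Matrix n
  S = diag s

  S-signature : IsSignatureMatrix S
  S-signature = (λ i j i≢j → diag-off s i≢j) ,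
                (λ i → Data.Sum.map (trans (diag-on s i)) (trans (diag-on s i)) (sign-±1 (label i)))

  SS-unitʳ : ∀ M → M · (S · S) ≐ M
  SS-unitʳ M i j = begin
    (M · (S · S)) i j                ≡⟨ ·-cong {A = M} (λ _ _ → refl) (diag-·-diag s s) i j ⟩
    (M · diag (λ k → s k * s k)) i j ≡⟨ ·-diag M _ i j ⟩
    M i j * (s j * s j)              ≡⟨ cong (M i j *_) (sign-square (label j)) ⟩
    M i j * 1#                       ≡⟨ *-identityʳ (M i j) ⟩
    M i j                            ∎
    where open ≡-Reasoning

  SMS-nonneg : ∀ {M} → NonNegative M → (∀ i j → M i j ≡ 0# ⊎ label j ≡ label i) → NonNegative (S · M · S)
  SMS-nonneg {M} 0≤M labels i j = subst (0# ≤_) (sym (diag-·-·-diag s M s i j)) (entry (labels i j))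
    where
    entry : M i j ≡ 0# ⊎ label j ≡ label i → 0# ≤ s i * M i j * s j
    entry (inj₁ M≡0)  = subst (0# ≤_) (sym (y≡0⇒x*y*z≡0 (s i) (s j) M≡0)) ≤-refl
    entry (inj₂ same) = subst (0# ≤_) (sym (trans (cong (λ p → s i * M i j * sign p) same) (sign-conj (label i) (M i j))))
                          (0≤M i j)

  SMS-nonpos : ∀ {M} → NonNegative M → (∀ i j → M i j ≡ 0# ⊎ label j ≡ label i ⁻¹) → NonNegative (-ᴹ (S · M · S))
  SMS-nonpos {M} 0≤M labels i j = subst (0# ≤_) (sym (cong -_ (diag-·-·-diag s M s i j))) (entry (labels i j))
    where
    entry : M i j ≡ 0# ⊎ label j ≡ label i ⁻¹ → 0# ≤ - (s i * M i j * s j)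
    entry (inj₁ M≡0)  = subst (0# ≤_) (sym (trans (cong -_ (y≡0⇒x*y*z≡0 (s i) (s j) M≡0)) -0#≈0#)) ≤-refl
    entry (inj₂ flip) = subst (0# ≤_) (sym (trans (cong (λ p → - (s i * M i j * sign p)) flip)
                          (trans (cong -_ (sign-conj-flip (label i) (M i j))) (-‿involutive (M i j))))) (0≤M i j)

  SxS-nonneg : NonNegative (S · x · S)
  SxS-nonneg = NonNegative-resp (conj-peirceInverse SS-unitʳ b y y′)
    (+ᴹ-nonneg (+ᴹ-nonneg SyS Sy′S) (·-nonneg (·-nonneg Sy′S (SMS-nonpos b-nonneg b-labels)) SyS))
    where
    SyS  = SMS-nonneg y-nonneg y-labels
    Sy′S = SMS-nonneg y′-nonneg y′-labels

  groupInverse-signed : ∀ X → IsGroupInverse A X → NonNegative (S · X · S)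
  groupInverse-signed X X-inverse =
    NonNegative-resp (·-cong (·-cong {A = S} (λ _ _ → refl) X≐x) (λ _ _ → refl)) SxS-nonneg
    where
    X≐x : X ≐ x
    X≐x = groupInverse-unique X-inverse groupInverse

theorem3p8 : (F : OrderedField) → let open Matrices F in
    (n : ℕ) (G : SimpleGraph n) (w : Matrix n) →
    InClassT G → SymmetricWeights w → PositiveWeights G w →
    (∃ λ X → IsGroupInverse (adjacency G w) X)
    × (∀ X → IsGroupInverse (adjacency G w) X →
         ∃ λ S → IsSignatureMatrix S × NonNegative ((S · X) · S))
-- the argument never uses symmetry of the weights
theorem3p8 F n G w ((connected , acyclic) , (r , r-core) , pendant-neighbour) _ w-pos =
  (x , groupInverse) , λ X X-inverse → S , S-signature , groupInverse-signed X X-inverse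
  where open PendantTree F G w w-pos connected acyclic r r-core pendant-neighbour
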